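{- Let $\alpha\in\mathbb{C}\setminus\{ -1,-2,-3,\ldots\}$ and $x\in\mathbb{C}$. Then for every $n\ge0$, $$\sum_{k=0}^n\frac{(-n)_k\,k!}{(1+n)_k(\alpha+1)_k}P_k^{(\alpha,-\alpha-1)}(x)=\frac{n!\left(\frac{1-x}2\right)^n+(\alpha+1)_n}{2(\alpha+1)_n}.$$
   Context: Rising factorial: $(\gamma)_0=1$, $(\gamma)_k=\gamma(\gamma+1)\cdots(\gamma+k-1)$. The Jacobi polynomials are $P_n^{(\alpha,\beta)}(x)=\frac{(\alpha+1)_n}{n!}\sum_{j=0}^n\frac{(-n)_j(n+\alpha+\beta+1)_j}{j!\,(\alpha+1)_j}\left(\frac{1-x}2\right)^j$. -}

module Defs where

open import Level using (Level; _⊔_) renaming (suc to lsuc)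
open import Data.Nat as ℕ using (ℕ; zero; suc; _!; NonZero)
open import Data.Nat.Properties using (_!≢0)
open import Relation.Nullary using (¬_)
open import Algebra.Bundles using (CommutativeRing)
import Relation.Binary.Reasoning.Setoid as SetoidReasoning

ιᴿ : ∀ {c ℓ} (R : CommutativeRing c ℓ) → ℕ → CommutativeRing.Carrier R
ιᴿ R zero    = CommutativeRing.0# R
ιᴿ R (suc n) = CommutativeRing._+_ R (CommutativeRing.1# R) (ιᴿ R n)

-- A field of characteristic zero (stand-in for ℂ): a commutative ring with
-- 0 ≠ 1, a multiplicative inverse for every nonzero element, and
-- 1 + 1 + ... + 1 (n+1 times) ≠ 0 for all n.
record CharZeroField (c ℓ : Level) : Set (lsuc (c ⊔ ℓ)) where
  field
    commutativeRing : CommutativeRing c ℓ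
  open CommutativeRing commutativeRing public
  field
    0≉1      : ¬ (0# ≈ 1#)
    _⁻¹      : (x : Carrier) → ¬ (x ≈ 0#) → Carrier
    ⁻¹-inverseʳ : ∀ x (p : ¬ (x ≈ 0#)) → x * (x ⁻¹) p ≈ 1#
    charZero : ∀ n → ¬ (ιᴿ commutativeRing (suc n) ≈ 0#)

  ι : ℕ → Carrier
  ι = ιᴿ commutativeRing

module FieldTheory {c ℓ} (F : CharZeroField c ℓ) where
  open CharZeroField F
  open SetoidReasoning setoid

  infixl 7 _/⟨_⟩
  _/⟨_⟩ : Carrier → {y : Carrier} → ¬ (y ≈ 0#) → Carrier
  _/⟨_⟩ x {y} p = x * (y ⁻¹) p

  pow : Carrier → ℕ → Carrier
  pow a zero    = 1#
  pow a (suc n) = pow a n * a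

  rising : Carrier → ℕ → Carrier
  rising γ zero    = 1#
  rising γ (suc k) = rising γ k * (γ + ι k)

  sumTo : ℕ → (ℕ → Carrier) → Carrier
  sumTo zero    f = f 0
  sumTo (suc n) f = sumTo n f + f (suc n)

  ι-+ : ∀ a b → ι (a ℕ.+ b) ≈ ι a + ι b
  ι-+ zero b = sym (+-identityˡ (ι b))
  ι-+ (suc a) b = begin
    1# + ι (a ℕ.+ b)  ≈⟨ +-congˡ (ι-+ a b) ⟩
    1# + (ι a + ι b)  ≈⟨ sym (+-assoc 1# (ι a) (ι b)) ⟩
    (1# + ι a) + ι b  ∎

  ι-nz : ∀ n → .{{NonZero n}} → ¬ (ι n ≈ 0#)
  ι-nz (suc n) = charZero n

  1≉0 : ¬ (1# ≈ 0#)
  1≉0 e = 0≉1 (sym e)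

  *-nz : ∀ {a b} → ¬ (a ≈ 0#) → ¬ (b ≈ 0#) → ¬ (a * b ≈ 0#)
  *-nz {a} {b} na nb ab0 = nb (begin
    b                    ≈⟨ sym (*-identityˡ b) ⟩
    1# * b               ≈⟨ *-congʳ (sym (⁻¹-inverseʳ a na)) ⟩
    (a * ai) * b         ≈⟨ *-congʳ (*-comm a ai) ⟩
    (ai * a) * b         ≈⟨ *-assoc ai a b ⟩
    ai * (a * b)         ≈⟨ *-congˡ ab0 ⟩
    ai * 0#              ≈⟨ zeroʳ ai ⟩
    0#                   ∎)
    where ai = (a ⁻¹) na

  rising-nz : ∀ {γ} → (∀ i → ¬ (γ + ι i ≈ 0#)) → ∀ k → ¬ (rising γ k ≈ 0#)
  rising-nz h zero    = 1≉0
  rising-nz h (suc k) = *-nz (rising-nz h k) (h k)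

  NotNegInt : Carrier → Set ℓ
  NotNegInt α = ∀ m → ¬ (α ≈ - ι (suc m))

  private
    solveNeg : ∀ {a b} → a + b ≈ 0# → a ≈ - b
    solveNeg {a} {b} e = begin
      a                ≈⟨ sym (+-identityʳ a) ⟩
      a + 0#           ≈⟨ +-congˡ (sym (-‿inverseʳ b)) ⟩
      a + (b + - b)    ≈⟨ sym (+-assoc a b (- b)) ⟩
      (a + b) + - b    ≈⟨ +-congʳ e ⟩
      0# + - b         ≈⟨ +-identityˡ (- b) ⟩
      - b              ∎

  α+1-factor-nz : ∀ {α} → NotNegInt α → ∀ i → ¬ ((α + 1#) + ι i ≈ 0#)
  α+1-factor-nz {α} h i e = h i (solveNeg (trans (sym (+-assoc α 1# (ι i))) e))

  pochα-nz : ∀ {α} → NotNegInt α → ∀ k → ¬ (rising (α + 1#) k ≈ 0#)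
  pochα-nz h = rising-nz (α+1-factor-nz h)

  poch1n-nz : ∀ n k → ¬ (rising (ι (suc n)) k ≈ 0#)
  poch1n-nz n = rising-nz helper
    where
    helper : ∀ i → ¬ (ι (suc n) + ι i ≈ 0#)
    helper i e = charZero (n ℕ.+ i) (trans (ι-+ (suc n) i) e)

  fact-nz : ∀ k → ¬ (ι (k !) ≈ 0#)
  fact-nz k = ι-nz (k !) {{k !≢0}}

  two-nz : ¬ (ι 2 ≈ 0#)
  two-nz = charZero 1

  half1-x : Carrier → Carrier
  half1-x x = (1# - x) /⟨ two-nz ⟩

  jacobiP : (n : ℕ) (α : Carrier) → NotNegInt α → (β x : Carrier) → Carrier
  jacobiP n α hα β x =
    (rising (α + 1#) n /⟨ fact-nz n ⟩) *
    sumTo n (λ j →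
      ((rising (- ι n) j * rising (ι n + α + β + 1#) j)
         /⟨ *-nz (fact-nz j) (pochα-nz hα j) ⟩)
      * pow (half1-x x) j)

-- With β = -α-1 we have k+α+β+1 = k, so P_k^(α,β)(x) = (α+1)_k/k! Σ_j (-k)_j (k)_j h^j / (j! (α+1)_j)
-- with h = (1-x)/2.  Exchanging the order of summation turns the left side into
-- Σ_j h^j / (j! (α+1)_j) E_j, where E_j = Σ_{k≤n} (-n)_k/(1+n)_k (-k)_j (k)_j.
-- The summand of E_j is Gosper-summable with certificate (k-j)(k+n)/k, and the
-- sum telescopes, its upper boundary term vanishing because (-n)_{n+1} = 0;
-- this gives 2(n-j) E_j = n [j = 0].
-- Hence for n ≥ 1 only j = 0 and j = n survive: 2E_0 = 1, and directly
-- 2E_n = 2 (n!)² (n)_n/(n+1)_n = (n!)².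

module Submission where

open import Defs
open import Level using (Level; 0ℓ)
open import Data.Nat as ℕ using (ℕ; zero; suc; _!; _<_; _≤_; z≤n; s≤s; NonZero)
import Data.Nat.Properties as ℕ
open import Data.Product using (_×_; _,_)
open import Data.Sum using (inj₁; inj₂)
open import Data.Maybe using (Maybe; just; nothing)
open import Relation.Nullary using (¬_; yes; no)
open import Relation.Binary.PropositionalEquality as ≡ using (_≡_)
open import Algebra.Bundles using (CommutativeRing; RawRing)
import Algebra.Solver.Ring.AlmostCommutativeRing as AlmostCommutativeRing
import Relation.Binary.Reasoning.Setoid as SetoidReasoning
import Algebra.Properties.Semiring.Mult

-- A ring solver for commutative rings whose constants are integers, each
-- encoded by a pair (a , b) standing for a - b.
module IntegerCoefficientSolver {c ℓ} (R : CommutativeRing c ℓ) where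
  open CommutativeRing R
  open SetoidReasoning setoid
  open import Algebra.Properties.Ring ring using (-‿anti-homo-+; -‿involutive; -0#≈0#; x[y-z]≈xy-xz; [y-z]x≈yx-zx)
  open import Algebra.Properties.CommutativeSemigroup +-commutativeSemigroup using (interchange)
  module Mult = Algebra.Properties.Semiring.Mult semiring

  ι : ℕ → Carrier
  ι = ιᴿ R

  ι≡×1# : ∀ n → ι n ≡ n Mult.× 1#
  ι≡×1# zero    = ≡.refl
  ι≡×1# (suc n) = ≡.cong (1# +_) (ι≡×1# n)

  ι-homo-+ : ∀ m n → ι (m ℕ.+ n) ≈ ι m + ι n
  ι-homo-+ m n rewrite ι≡×1# m | ι≡×1# n | ι≡×1# (m ℕ.+ n) = Mult.×-homo-+ 1# m n

  ι-homo-* : ∀ m n → ι (m ℕ.* n) ≈ ι m * ι n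
  ι-homo-* m n rewrite ι≡×1# m | ι≡×1# n | ι≡×1# (m ℕ.* n) = Mult.×1-homo-* m n

  -- The solver compares normal forms up to definitional equality, so equal
  -- integers must get equal codes: `reduce` cancels the common part of a pair.
  reduce : ℕ × ℕ → ℕ × ℕ
  reduce (suc a , suc b) = reduce (a , b)
  reduce p               = p

  ℤ-rawRing : RawRing 0ℓ 0ℓ
  ℤ-rawRing = record
    { Carrier = ℕ × ℕ
    ; _≈_     = _≡_
    ; _+_     = λ { (a , b) (a′ , b′) → reduce (a ℕ.+ a′ , b ℕ.+ b′) }
    ; _*_     = λ { (a , b) (a′ , b′) → reduce (a ℕ.* a′ ℕ.+ b ℕ.* b′ , a ℕ.* b′ ℕ.+ b ℕ.* a′) }
    ; -_      = λ { (a , b) → (b , a) }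
    ; 0#      = 0 , 0
    ; 1#      = 1 , 0
    }

  -- (1 , 0) and (n , 0) denote 1# and ι n on the nose, so that the constants
  -- :1 and :2 below match 1# and ι 2 in goals definitionally.
  ⟦_⟧ᶜ : ℕ × ℕ → Carrier
  ⟦ 1 , 0     ⟧ᶜ = 1#
  ⟦ a , 0     ⟧ᶜ = ι a
  ⟦ a , suc b ⟧ᶜ = ι a - ι (suc b)

  private
    -‿distrib-+ : ∀ x y → - (x + y) ≈ - x + - y
    -‿distrib-+ x y = trans (-‿anti-homo-+ x y) (+-comm (- y) (- x))

    -‿+-interchange : ∀ x y z w → (x + y) - (z + w) ≈ (x - z) + (y - w)
    -‿+-interchange x y z w = trans (+-congˡ (-‿distrib-+ z w)) (interchange x y (- z) (- w))

    +-cancel-- : ∀ x y z → (z + x) - (z + y) ≈ x - y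
    +-cancel-- x y z = begin
      (z + x) - (z + y)  ≈⟨ -‿+-interchange z x z y ⟩
      (z - z) + (x - y)  ≈⟨ +-congʳ (-‿inverseʳ z) ⟩
      0# + (x - y)       ≈⟨ +-identityˡ (x - y) ⟩
      x - y              ∎

    -‿flip : ∀ x y → - (x - y) ≈ y - x
    -‿flip x y = begin
      - (x - y)   ≈⟨ -‿distrib-+ x (- y) ⟩
      - x + - - y ≈⟨ +-congˡ (-‿involutive y) ⟩
      - x + y     ≈⟨ +-comm (- x) y ⟩
      y - x       ∎

    -‿balance : ∀ {x y z w} → x + w ≈ z + y → x - y ≈ z - w
    -‿balance {x} {y} {z} {w} e = begin
      x - y              ≈⟨ sym (+-cancel-- x y w) ⟩
      (w + x) - (w + y)  ≈⟨ +-cong (trans (+-comm w x) e) (-‿cong (+-comm w y)) ⟩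
      (z + y) - (y + w)  ≈⟨ +-congʳ (+-comm z y) ⟩
      (y + z) - (y + w)  ≈⟨ +-cancel-- z w y ⟩
      z - w              ∎

    -‿*-expand : ∀ x y z w → (x - y) * (z - w) ≈ (x * z + y * w) - (x * w + y * z)
    -‿*-expand x y z w = begin
      (x - y) * (z - w)                           ≈⟨ [y-z]x≈yx-zx (z - w) x y ⟩
      x * (z - w) - y * (z - w)                   ≈⟨ +-cong (x[y-z]≈xy-xz x z w) (-‿cong (x[y-z]≈xy-xz y z w)) ⟩
      (x * z - x * w) - (y * z - y * w)           ≈⟨ +-congˡ (-‿flip (y * z) (y * w)) ⟩
      (x * z - x * w) + (y * w - y * z)           ≈⟨ interchange (x * z) (- (x * w)) (y * w) (- (y * z)) ⟩
      (x * z + y * w) + (- (x * w) + - (y * z))   ≈⟨ +-congˡ (sym (-‿distrib-+ (x * w) (y * z))) ⟩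
      (x * z + y * w) - (x * w + y * z)           ∎

  ⟦⟧-spec : ∀ a b → ⟦ a , b ⟧ᶜ ≈ ι a - ι b
  ⟦⟧-spec 0             0       = sym (trans (+-identityˡ (- 0#)) -0#≈0#)
  ⟦⟧-spec 1             0       = sym (trans (+-cong (+-identityʳ 1#) -0#≈0#) (+-identityʳ 1#))
  ⟦⟧-spec (suc (suc a)) 0       = sym (trans (+-congˡ -0#≈0#) (+-identityʳ _))
  ⟦⟧-spec 0             (suc b) = refl
  ⟦⟧-spec 1             (suc b) = refl
  ⟦⟧-spec (suc (suc a)) (suc b) = refl

  ⟦reduce⟧ : ∀ a b → ⟦ reduce (a , b) ⟧ᶜ ≈ ι a - ι b
  ⟦reduce⟧ zero    b       = ⟦⟧-spec 0 b
  ⟦reduce⟧ (suc a) zero    = ⟦⟧-spec (suc a) 0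
  ⟦reduce⟧ (suc a) (suc b) = trans (⟦reduce⟧ a b) (sym (+-cancel-- (ι a) (ι b) 1#))

  homomorphism : ℤ-rawRing AlmostCommutativeRing.-Raw-AlmostCommutative⟶ AlmostCommutativeRing.fromCommutativeRing R
  homomorphism = record
    { ⟦_⟧    = ⟦_⟧ᶜ
    ; +-homo = +-homo
    ; *-homo = *-homo
    ; -‿homo = -‿homo
    ; 0-homo = refl
    ; 1-homo = refl
    }
    where
    +-homo : ∀ p q → ⟦ RawRing._+_ ℤ-rawRing p q ⟧ᶜ ≈ ⟦ p ⟧ᶜ + ⟦ q ⟧ᶜ
    +-homo (a , b) (a′ , b′) = begin
      ⟦ reduce (a ℕ.+ a′ , b ℕ.+ b′) ⟧ᶜ  ≈⟨ ⟦reduce⟧ (a ℕ.+ a′) (b ℕ.+ b′) ⟩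
      ι (a ℕ.+ a′) - ι (b ℕ.+ b′)        ≈⟨ +-cong (ι-homo-+ a a′) (-‿cong (ι-homo-+ b b′)) ⟩
      (ι a + ι a′) - (ι b + ι b′)        ≈⟨ -‿+-interchange _ _ _ _ ⟩
      (ι a - ι b) + (ι a′ - ι b′)        ≈⟨ sym (+-cong (⟦⟧-spec a b) (⟦⟧-spec a′ b′)) ⟩
      ⟦ a , b ⟧ᶜ + ⟦ a′ , b′ ⟧ᶜ          ∎

    *-homo : ∀ p q → ⟦ RawRing._*_ ℤ-rawRing p q ⟧ᶜ ≈ ⟦ p ⟧ᶜ * ⟦ q ⟧ᶜ
    *-homo (a , b) (a′ , b′) = begin
      ⟦ reduce (a ℕ.* a′ ℕ.+ b ℕ.* b′ , a ℕ.* b′ ℕ.+ b ℕ.* a′) ⟧ᶜ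
        ≈⟨ ⟦reduce⟧ (a ℕ.* a′ ℕ.+ b ℕ.* b′) (a ℕ.* b′ ℕ.+ b ℕ.* a′) ⟩
      ι (a ℕ.* a′ ℕ.+ b ℕ.* b′) - ι (a ℕ.* b′ ℕ.+ b ℕ.* a′)
        ≈⟨ +-cong (ι-homo-+ (a ℕ.* a′) (b ℕ.* b′)) (-‿cong (ι-homo-+ (a ℕ.* b′) (b ℕ.* a′))) ⟩
      (ι (a ℕ.* a′) + ι (b ℕ.* b′)) - (ι (a ℕ.* b′) + ι (b ℕ.* a′))
        ≈⟨ +-cong (+-cong (ι-homo-* a a′) (ι-homo-* b b′)) (-‿cong (+-cong (ι-homo-* a b′) (ι-homo-* b a′))) ⟩
      (ι a * ι a′ + ι b * ι b′) - (ι a * ι b′ + ι b * ι a′)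
        ≈⟨ sym (-‿*-expand (ι a) (ι b) (ι a′) (ι b′)) ⟩
      (ι a - ι b) * (ι a′ - ι b′)
        ≈⟨ sym (*-cong (⟦⟧-spec a b) (⟦⟧-spec a′ b′)) ⟩
      ⟦ a , b ⟧ᶜ * ⟦ a′ , b′ ⟧ᶜ
        ∎

    -‿homo : ∀ p → ⟦ RawRing.-_ ℤ-rawRing p ⟧ᶜ ≈ - ⟦ p ⟧ᶜ
    -‿homo (a , b) = begin
      ⟦ b , a ⟧ᶜ     ≈⟨ ⟦⟧-spec b a ⟩
      ι b - ι a      ≈⟨ sym (-‿flip (ι a) (ι b)) ⟩
      - (ι a - ι b)  ≈⟨ -‿cong (sym (⟦⟧-spec a b)) ⟩
      - ⟦ a , b ⟧ᶜ   ∎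

  ⟦⟧-equal? : ∀ p q → Maybe (⟦ p ⟧ᶜ ≈ ⟦ q ⟧ᶜ)
  ⟦⟧-equal? (a , b) (a′ , b′) with a ℕ.+ b′ ℕ.≟ a′ ℕ.+ b
  ... | no _  = nothing
  ... | yes e = just (begin
    ⟦ a , b ⟧ᶜ     ≈⟨ ⟦⟧-spec a b ⟩
    ι a - ι b      ≈⟨ -‿balance (trans (sym (ι-homo-+ a b′)) (trans (reflexive (≡.cong ι e)) (ι-homo-+ a′ b))) ⟩
    ι a′ - ι b′    ≈⟨ sym (⟦⟧-spec a′ b′) ⟩
    ⟦ a′ , b′ ⟧ᶜ   ∎)

  open import Algebra.Solver.Ring ℤ-rawRing (AlmostCommutativeRing.fromCommutativeRing R) homomorphism ⟦⟧-equal? public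
    using (solve; _:=_; Polynomial; con; _:+_; _:*_; _:-_; :-_)

  :0 :1 :2 : ∀ {n} → Polynomial n
  :0 = con (0 , 0)
  :1 = con (1 , 0)
  :2 = con (2 , 0)

module JacobiSum {c ℓ} (F : CharZeroField c ℓ) where
  open CharZeroField F
  open FieldTheory F
  open SetoidReasoning setoid
  open IntegerCoefficientSolver commutativeRing
    using (ι-homo-*; solve; _:=_; _:+_; _:*_; _:-_; :-_; :0; :1; :2)
  open import Algebra.Properties.Ring ring using (-0#≈0#)
  open import Algebra.Properties.CommutativeSemigroup +-commutativeSemigroup using (interchange)

  ⁻¹-inverseˡ : ∀ a (p : ¬ (a ≈ 0#)) → (a ⁻¹) p * a ≈ 1#
  ⁻¹-inverseˡ a p = trans (*-comm ((a ⁻¹) p) a) (⁻¹-inverseʳ a p)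

  *-cancelˡ : ∀ {a x y} → ¬ (a ≈ 0#) → a * x ≈ a * y → x ≈ y
  *-cancelˡ {a} {x} {y} p e = begin
    x                   ≈⟨ sym (*-identityˡ x) ⟩
    1# * x              ≈⟨ *-congʳ (sym (⁻¹-inverseˡ a p)) ⟩
    ((a ⁻¹) p * a) * x  ≈⟨ *-assoc ((a ⁻¹) p) a x ⟩
    (a ⁻¹) p * (a * x)  ≈⟨ *-congˡ e ⟩
    (a ⁻¹) p * (a * y)  ≈⟨ sym (*-assoc ((a ⁻¹) p) a y) ⟩
    ((a ⁻¹) p * a) * y  ≈⟨ *-congʳ (⁻¹-inverseˡ a p) ⟩
    1# * y              ≈⟨ *-identityˡ y ⟩
    y                   ∎

  ⁻¹-unique : ∀ {a z} (p : ¬ (a ≈ 0#)) → a * z ≈ 1# → (a ⁻¹) p ≈ z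
  ⁻¹-unique {a} p e = *-cancelˡ p (trans (⁻¹-inverseʳ a p) (sym e))

  ⁻¹-*-cancelʳ : ∀ {a b} (p : ¬ (a * b ≈ 0#)) (q : ¬ (a ≈ 0#)) → ((a * b) ⁻¹) p * b ≈ (a ⁻¹) q
  ⁻¹-*-cancelʳ {a} {b} p q = sym (⁻¹-unique q (begin
    a * (((a * b) ⁻¹) p * b)  ≈⟨ solve 3 (λ a b i → a :* (i :* b) := (a :* b) :* i) refl a b (((a * b) ⁻¹) p) ⟩
    (a * b) * ((a * b) ⁻¹) p  ≈⟨ ⁻¹-inverseʳ (a * b) p ⟩
    1#                        ∎))

  y*z≈x⇒z≈x/y : ∀ {x y z} (p : ¬ (y ≈ 0#)) → y * z ≈ x → z ≈ x /⟨ p ⟩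
  y*z≈x⇒z≈x/y {x} {y} {z} p e = *-cancelˡ p (begin
    y * z                 ≈⟨ e ⟩
    x                     ≈⟨ sym (*-identityʳ x) ⟩
    x * 1#                ≈⟨ *-congˡ (sym (⁻¹-inverseʳ y p)) ⟩
    x * (y * (y ⁻¹) p)    ≈⟨ solve 3 (λ x y i → x :* (y :* i) := y :* (x :* i)) refl x y ((y ⁻¹) p) ⟩
    y * (x /⟨ p ⟩)        ∎)

  ι-sub-nz : ∀ {j n} → j < n → ¬ (ι n - ι j ≈ 0#)
  ι-sub-nz {j} j<n with ℕ.m≤n⇒∃[o]m+o≡n j<n
  ... | o , ≡.refl = λ e → charZero o (begin
    1# + ι o                  ≈⟨ solve 2 (λ υ ω → :1 :+ ω := (:1 :+ (υ :+ ω)) :- υ) refl (ι j) (ι o) ⟩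
    (1# + (ι j + ι o)) - ι j  ≈⟨ +-congʳ (+-congˡ (sym (ι-+ j o))) ⟩
    ι (suc j ℕ.+ o) - ι j     ≈⟨ e ⟩
    0#                        ∎)

  -- Finite sums

  sumTo-cong : ∀ n {f g : ℕ → Carrier} → (∀ k → k ≤ n → f k ≈ g k) → sumTo n f ≈ sumTo n g
  sumTo-cong zero    f≈g = f≈g 0 z≤n
  sumTo-cong (suc n) f≈g = +-cong (sumTo-cong n (λ k k≤n → f≈g k (ℕ.m≤n⇒m≤1+n k≤n))) (f≈g (suc n) ℕ.≤-refl)

  sumTo-distrib-+ : ∀ n (f g : ℕ → Carrier) → sumTo n (λ k → f k + g k) ≈ sumTo n f + sumTo n g
  sumTo-distrib-+ zero    f g = refl
  sumTo-distrib-+ (suc n) f g = trans (+-congʳ (sumTo-distrib-+ n f g)) (interchange _ _ _ _)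

  *-distribˡ-sumTo : ∀ n a (f : ℕ → Carrier) → a * sumTo n f ≈ sumTo n (λ k → a * f k)
  *-distribˡ-sumTo zero    a f = refl
  *-distribˡ-sumTo (suc n) a f = trans (distribˡ a (sumTo n f) (f (suc n))) (+-congʳ (*-distribˡ-sumTo n a f))

  sumTo-comm : ∀ n m (f : ℕ → ℕ → Carrier) →
               sumTo n (λ k → sumTo m (f k)) ≈ sumTo m (λ j → sumTo n (λ k → f k j))
  sumTo-comm zero    m f = refl
  sumTo-comm (suc n) m f = begin
    sumTo n (λ k → sumTo m (f k)) + sumTo m (f (suc n))          ≈⟨ +-congʳ (sumTo-comm n m f) ⟩
    sumTo m (λ j → sumTo n (λ k → f k j)) + sumTo m (f (suc n))  ≈⟨ sym (sumTo-distrib-+ m _ (f (suc n))) ⟩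
    sumTo m (λ j → sumTo n (λ k → f k j) + f (suc n) j)          ∎

  sumTo-extend : ∀ {k n} (f : ℕ → Carrier) → (∀ j → k < j → f j ≈ 0#) → k ≤ n → sumTo k f ≈ sumTo n f
  sumTo-extend {n = zero}  f f≈0 z≤n = refl
  sumTo-extend {k} {suc n} f f≈0 k≤1+n with ℕ.m≤n⇒m<n∨m≡n k≤1+n
  ... | inj₂ ≡.refl    = refl
  ... | inj₁ (s≤s k≤n) = begin
    sumTo k f              ≈⟨ sumTo-extend f f≈0 k≤n ⟩
    sumTo n f              ≈⟨ sym (+-identityʳ (sumTo n f)) ⟩
    sumTo n f + 0#         ≈⟨ +-congˡ (sym (f≈0 (suc n) (s≤s k≤n))) ⟩
    sumTo n f + f (suc n)  ∎

  sumTo-last : ∀ n (f : ℕ → Carrier) → (∀ k → k < n → f k ≈ 0#) → sumTo n f ≈ f n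
  sumTo-last zero    f f≈0 = refl
  sumTo-last (suc n) f f≈0 = begin
    sumTo n f + f (suc n)  ≈⟨ +-congʳ (trans (sumTo-last n f (λ k k<n → f≈0 k (ℕ.m<n⇒m<1+n k<n))) (f≈0 n ℕ.≤-refl)) ⟩
    0# + f (suc n)         ≈⟨ +-identityˡ (f (suc n)) ⟩
    f (suc n)              ∎

  sumTo-first : ∀ n (f : ℕ → Carrier) → (∀ k → 0 < k → k ≤ n → f k ≈ 0#) → sumTo n f ≈ f 0
  sumTo-first zero    f f≈0 = refl
  sumTo-first (suc n) f f≈0 = begin
    sumTo n f + f (suc n)  ≈⟨ +-cong (sumTo-first n f (λ k 0<k k≤n → f≈0 k 0<k (ℕ.m≤n⇒m≤1+n k≤n))) (f≈0 (suc n) (s≤s z≤n) ℕ.≤-refl) ⟩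
    f 0 + 0#               ≈⟨ +-identityʳ (f 0) ⟩
    f 0                    ∎

  sumTo-triangle-comm : ∀ n (f : ℕ → ℕ → Carrier) → (∀ k j → k < j → f k j ≈ 0#) →
                        sumTo n (λ k → sumTo k (f k)) ≈ sumTo n (λ j → sumTo n (λ k → f k j))
  sumTo-triangle-comm n f f≈0 = begin
    sumTo n (λ k → sumTo k (f k))          ≈⟨ sumTo-cong n (λ k k≤n → sumTo-extend (f k) (f≈0 k) k≤n) ⟩
    sumTo n (λ k → sumTo n (f k))          ≈⟨ sumTo-comm n n f ⟩
    sumTo n (λ j → sumTo n (λ k → f k j))  ∎

  -- Rising factorials

  rising-cong : ∀ {γ δ} → γ ≈ δ → ∀ k → rising γ k ≈ rising δ k
  rising-cong γ≈δ zero    = refl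
  rising-cong γ≈δ (suc k) = *-cong (rising-cong γ≈δ k) (+-congʳ γ≈δ)

  rising-sucˡ : ∀ γ k → rising γ (suc k) ≈ γ * rising (γ + 1#) k
  rising-sucˡ γ zero    = solve 1 (λ γ → :1 :* (γ :+ :0) := γ :* :1) refl γ
  rising-sucˡ γ (suc k) = begin
    rising γ (suc k) * (γ + (1# + ι k))          ≈⟨ *-congʳ (rising-sucˡ γ k) ⟩
    (γ * rising (γ + 1#) k) * (γ + (1# + ι k))   ≈⟨ solve 3 (λ γ r κ → (γ :* r) :* (γ :+ (:1 :+ κ)) := γ :* (r :* ((γ :+ :1) :+ κ)))
                                                           refl γ (rising (γ + 1#) k) (ι k) ⟩
    γ * rising (γ + 1#) (suc k)                  ∎

  rising-neg-ι-vanishes : ∀ {k j} → k < j → rising (- ι k) j ≈ 0#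
  rising-neg-ι-vanishes {k} {suc j} (s≤s k≤j) with ℕ.m≤n⇒m<n∨m≡n k≤j
  ... | inj₁ k<j      = trans (*-congʳ (rising-neg-ι-vanishes k<j)) (zeroˡ _)
  ... | inj₂ ≡.refl = trans (*-congˡ (-‿inverseˡ (ι k))) (zeroʳ _)

  rising-neg-ι-square : ∀ n → rising (- ι n) n * rising (- ι n) n ≈ ι (n !) * ι (n !)
  rising-neg-ι-square zero    = solve 0 (:1 :* :1 := (:1 :+ :0) :* (:1 :+ :0)) refl
  rising-neg-ι-square (suc n) = begin
    rising (- ι (suc n)) (suc n) * rising (- ι (suc n)) (suc n)
      ≈⟨ *-cong diagonal diagonal ⟩
    (- ι (suc n) * rising (- ι n) n) * (- ι (suc n) * rising (- ι n) n)
      ≈⟨ solve 2 (λ ν r → (:- ν :* r) :* (:- ν :* r) := (ν :* ν) :* (r :* r)) refl (ι (suc n)) (rising (- ι n) n) ⟩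
    (ι (suc n) * ι (suc n)) * (rising (- ι n) n * rising (- ι n) n)
      ≈⟨ *-congˡ (rising-neg-ι-square n) ⟩
    (ι (suc n) * ι (suc n)) * (ι (n !) * ι (n !))
      ≈⟨ solve 2 (λ ν f → (ν :* ν) :* (f :* f) := (ν :* f) :* (ν :* f)) refl (ι (suc n)) (ι (n !)) ⟩
    (ι (suc n) * ι (n !)) * (ι (suc n) * ι (n !))
      ≈⟨ sym (*-cong (ι-homo-* (suc n) (n !)) (ι-homo-* (suc n) (n !))) ⟩
    ι (suc n !) * ι (suc n !)
      ∎
    where
    diagonal : rising (- ι (suc n)) (suc n) ≈ - ι (suc n) * rising (- ι n) n
    diagonal = trans (rising-sucˡ (- ι (suc n)) n)
                     (*-congˡ (rising-cong (solve 1 (λ ν → :- (:1 :+ ν) :+ :1 := :- ν) refl (ι n)) n))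

  rising-ι-double : ∀ n → .{{NonZero n}} → ι 2 * rising (ι n) n ≈ rising (ι (suc n)) n
  rising-ι-double n = *-cancelˡ (ι-nz n) (begin
    ι n * (ι 2 * rising (ι n) n)  ≈⟨ solve 2 (λ ν r → ν :* (:2 :* r) := r :* (ν :+ ν)) refl (ι n) (rising (ι n) n) ⟩
    rising (ι n) (suc n)          ≈⟨ rising-sucˡ (ι n) n ⟩
    ι n * rising (ι n + 1#) n     ≈⟨ *-congˡ (rising-cong (+-comm (ι n) 1#) n) ⟩
    ι n * rising (ι (suc n)) n    ∎)

  -- G k / k is Gosper's antidifference: the hypothesis (the term ratio of t,
  -- cleared of denominators) gives D t k = G k / k - G (suc k) / suc k for k ≥ 1.
  -- Multiplying through by suc m keeps the statement division-free at k = 0.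
  module Telescoping (t : ℕ → Carrier) (N J : Carrier) where
    G : ℕ → Carrier
    G k = t k * ((ι k - J) * (ι k + N))

    D : Carrier
    D = ι 2 * (N - J)

    telescoping : (∀ k → ι k * G (suc k) ≈ ι (suc k) * (t k * ((ι k - N) * (ι k + J)))) →
                  ∀ m → ι (suc m) * (D * sumTo m t) ≈ ι (suc m) * (D * t 0 + G 1) - G (suc m)
    telescoping cert zero =
      solve 3 (λ d t₀ g → (:1 :+ :0) :* (d :* t₀) := (:1 :+ :0) :* (d :* t₀ :+ g) :- g) refl D (t 0) (G 1)
    telescoping cert (suc m) = *-cancelˡ (charZero m) (begin
      M * (M′ * (D * (S + t₁)))
        ≈⟨ solve 5 (λ μ s t₁ n j → μ :* ((:1 :+ μ) :* (:2 :* (n :- j) :* (s :+ t₁)))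
                                   := (:1 :+ μ) :* (μ :* (:2 :* (n :- j) :* s)) :+ (:1 :+ μ) :* (:2 :* (n :- j) :* μ :* t₁))
                 refl M S t₁ N J ⟩
      M′ * (M * (D * S)) + M′ * (D * M * t₁)
        ≈⟨ +-congʳ (*-congˡ (telescoping cert m)) ⟩
      M′ * (M * C - G (suc m)) + M′ * (D * M * t₁)
        ≈⟨ solve 5 (λ μ c t₁ n j → (:1 :+ μ) :* (μ :* c :- t₁ :* ((μ :- j) :* (μ :+ n))) :+ (:1 :+ μ) :* (:2 :* (n :- j) :* μ :* t₁)
                                   := μ :* ((:1 :+ μ) :* c) :- (:1 :+ μ) :* (t₁ :* ((μ :- n) :* (μ :+ j))))
                 refl M C t₁ N J ⟩
      M * (M′ * C) - M′ * (t₁ * ((M - N) * (M + J)))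
        ≈⟨ +-congˡ (-‿cong (sym (cert (suc m)))) ⟩
      M * (M′ * C) - M * G (suc (suc m))
        ≈⟨ solve 4 (λ μ μ′ c g → μ :* (μ′ :* c) :- μ :* g := μ :* (μ′ :* c :- g)) refl M M′ C (G (suc (suc m))) ⟩
      M * (M′ * C - G (suc (suc m)))
        ∎)
      where
      M = ι (suc m)
      M′ = ι (suc (suc m))
      S = sumTo m t
      t₁ = t (suc m)
      C = D * t 0 + G 1

  -- The inner sums E_j

  risingRatio : ℕ → ℕ → Carrier
  risingRatio n k = rising (- ι n) k /⟨ poch1n-nz n k ⟩

  risingProduct : ℕ → ℕ → Carrier
  risingProduct k j = rising (- ι k) j * rising (ι k) j

  innerSum : ℕ → ℕ → Carrier
  innerSum n j = sumTo n (λ k → risingRatio n k * risingProduct k j)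

  risingRatio-zero : ∀ n → risingRatio n 0 ≈ 1#
  risingRatio-zero n = trans (*-identityˡ _) (⁻¹-unique (poch1n-nz n 0) (*-identityˡ 1#))

  risingRatio-suc : ∀ n k → risingRatio n (suc k) * (ι (suc n) + ι k) ≈ risingRatio n k * (- ι n + ι k)
  risingRatio-suc n k = begin
    (R * (- ι n + ι k)) * Q⁻¹ * (ι (suc n) + ι k)    ≈⟨ *-assoc (R * (- ι n + ι k)) Q⁻¹ (ι (suc n) + ι k) ⟩
    (R * (- ι n + ι k)) * (Q⁻¹ * (ι (suc n) + ι k))  ≈⟨ *-congˡ (⁻¹-*-cancelʳ (poch1n-nz n (suc k)) (poch1n-nz n k)) ⟩
    (R * (- ι n + ι k)) * P⁻¹                        ≈⟨ solve 3 (λ r x p → (r :* x) :* p := (r :* p) :* x) refl R (- ι n + ι k) P⁻¹ ⟩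
    (R * P⁻¹) * (- ι n + ι k)                        ∎
    where
    R = rising (- ι n) k
    P⁻¹ = (rising (ι (suc n)) k ⁻¹) (poch1n-nz n k)
    Q⁻¹ = (rising (ι (suc n)) (suc k) ⁻¹) (poch1n-nz n (suc k))

  risingRatio-vanishes : ∀ n → risingRatio n (suc n) ≈ 0#
  risingRatio-vanishes n = trans (*-congʳ (rising-neg-ι-vanishes (ℕ.n<1+n n))) (zeroˡ _)

  risingProduct-suc : ∀ k j → risingProduct (suc k) j * ((- ι (suc k) + ι j) * ι k)
                              ≈ risingProduct k j * (- ι (suc k) * (ι k + ι j))
  risingProduct-suc k j = begin
    (rising γ j * rising (ι (suc k)) j) * ((γ + ι j) * ι k)
      ≈⟨ solve 4 (λ r₁ r₂ x κ → (r₁ :* r₂) :* (x :* κ) := (r₁ :* x) :* (κ :* r₂)) refl (rising γ j) (rising (ι (suc k)) j) (γ + ι j) (ι k) ⟩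
    rising γ (suc j) * (ι k * rising (ι (suc k)) j)
      ≈⟨ *-cong (rising-sucˡ γ j) (*-congˡ (rising-cong (+-comm 1# (ι k)) j)) ⟩
    (γ * rising (γ + 1#) j) * (ι k * rising (ι k + 1#) j)
      ≈⟨ *-cong (*-congˡ (rising-cong (solve 1 (λ κ → :- (:1 :+ κ) :+ :1 := :- κ) refl (ι k)) j)) (sym (rising-sucˡ (ι k) j)) ⟩
    (γ * rising (- ι k) j) * rising (ι k) (suc j)
      ≈⟨ solve 5 (λ γ r₁ r₂ κ υ → (γ :* r₁) :* (r₂ :* (κ :+ υ)) := (r₁ :* r₂) :* (γ :* (κ :+ υ))) refl γ (rising (- ι k) j) (rising (ι k) j) (ι k) (ι j) ⟩
    risingProduct k j * (γ * (ι k + ι j))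
      ∎
    where γ = - ι (suc k)

  risingProduct-vanishes : ∀ {k j} → k < j → risingProduct k j ≈ 0#
  risingProduct-vanishes k<j = trans (*-congʳ (rising-neg-ι-vanishes k<j)) (zeroˡ _)

  module InnerSum (n j : ℕ) where
    term : ℕ → Carrier
    term k = risingRatio n k * risingProduct k j

    open Telescoping term (ι n) (ι j) public

    certificate : ∀ k → ι k * G (suc k) ≈ ι (suc k) * (term k * ((ι k - ι n) * (ι k + ι j)))
    certificate k = begin
      ι k * ((a′ * r′) * ((ι (suc k) - ι j) * (ι (suc k) + ι n)))
        ≈⟨ solve 5 (λ κ a′ r′ υ ν → κ :* ((a′ :* r′) :* (((:1 :+ κ) :- υ) :* ((:1 :+ κ) :+ ν)))
                                    := :- ((a′ :* ((:1 :+ ν) :+ κ)) :* (r′ :* ((:- (:1 :+ κ) :+ υ) :* κ))))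
                 refl (ι k) a′ r′ (ι j) (ι n) ⟩
      - ((a′ * (ι (suc n) + ι k)) * (r′ * ((- ι (suc k) + ι j) * ι k)))
        ≈⟨ -‿cong (*-cong (risingRatio-suc n k) (risingProduct-suc k j)) ⟩
      - ((a * (- ι n + ι k)) * (r * (- ι (suc k) * (ι k + ι j))))
        ≈⟨ solve 5 (λ κ a r υ ν → :- ((a :* (:- ν :+ κ)) :* (r :* (:- (:1 :+ κ) :* (κ :+ υ))))
                                  := (:1 :+ κ) :* ((a :* r) :* ((κ :- ν) :* (κ :+ υ))))
                 refl (ι k) a r (ι j) (ι n) ⟩
      ι (suc k) * ((a * r) * ((ι k - ι n) * (ι k + ι j)))
        ∎
      where
      a = risingRatio n k
      r = risingProduct k j
      a′ = risingRatio n (suc k)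
      r′ = risingProduct (suc k) j

    innerSum-telescoped : D * innerSum n j ≈ D * term 0 + G 1
    innerSum-telescoped = *-cancelˡ (charZero n) (begin
      ι (suc n) * (D * innerSum n j)                 ≈⟨ telescoping certificate n ⟩
      ι (suc n) * (D * term 0 + G 1) - G (suc n)     ≈⟨ +-congˡ (-‿cong G-vanishes) ⟩
      ι (suc n) * (D * term 0 + G 1) - 0#            ≈⟨ trans (+-congˡ -0#≈0#) (+-identityʳ _) ⟩
      ι (suc n) * (D * term 0 + G 1)                 ∎)
      where
      G-vanishes : G (suc n) ≈ 0#
      G-vanishes = trans (*-congʳ (trans (*-congʳ (risingRatio-vanishes n)) (zeroˡ _))) (zeroˡ _)

  innerSum-zero : ∀ n → .{{NonZero n}} → ι 2 * innerSum n 0 ≈ 1#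
  innerSum-zero n = *-cancelˡ (ι-nz n) (begin
    ι n * (ι 2 * innerSum n 0)
      ≈⟨ solve 2 (λ ν s → ν :* (:2 :* s) := :2 :* (ν :- :0) :* s) refl (ι n) (innerSum n 0) ⟩
    D * innerSum n 0
      ≈⟨ innerSum-telescoped ⟩
    D * term 0 + G 1
      ≈⟨ solve 3 (λ ν a₀ a₁ → :2 :* (ν :- :0) :* (a₀ :* (:1 :* :1)) :+ (a₁ :* (:1 :* :1)) :* (((:1 :+ :0) :- :0) :* ((:1 :+ :0) :+ ν))
                             := :2 :* ν :* a₀ :+ a₁ :* ((:1 :+ ν) :+ :0))
               refl (ι n) (risingRatio n 0) (risingRatio n 1) ⟩
    ι 2 * ι n * risingRatio n 0 + risingRatio n 1 * (ι (suc n) + ι 0)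
      ≈⟨ +-congˡ (risingRatio-suc n 0) ⟩
    ι 2 * ι n * risingRatio n 0 + risingRatio n 0 * (- ι n + ι 0)
      ≈⟨ solve 2 (λ ν a₀ → :2 :* ν :* a₀ :+ a₀ :* (:- ν :+ :0) := ν :* a₀) refl (ι n) (risingRatio n 0) ⟩
    ι n * risingRatio n 0
      ≈⟨ *-congˡ (risingRatio-zero n) ⟩
    ι n * 1#
      ∎)
    where open InnerSum n 0

  boundaryTerm-vanishes : ∀ n j → let open InnerSum n (suc j) in D * term 0 + G 1 ≈ 0#
  boundaryTerm-vanishes n j = begin
    D * term 0 + G 1  ≈⟨ +-cong (trans (*-congˡ term₀-vanishes) (zeroʳ D)) (G₁-vanishes j) ⟩
    0# + 0#           ≈⟨ +-identityʳ 0# ⟩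
    0#                ∎
    where
    open InnerSum n (suc j)
    term₀-vanishes : term 0 ≈ 0#
    term₀-vanishes = trans (*-congˡ (risingProduct-vanishes {0} {suc j} (s≤s z≤n))) (zeroʳ _)
    G₁-vanishes : ∀ j → InnerSum.G n (suc j) 1 ≈ 0#
    G₁-vanishes zero    = trans (*-congˡ (trans (*-congʳ (-‿inverseʳ (ι 1))) (zeroˡ _))) (zeroʳ _)
    G₁-vanishes (suc j) = trans (*-congʳ (trans (*-congˡ (risingProduct-vanishes {1} {2 ℕ.+ j} (s≤s (s≤s z≤n)))) (zeroʳ _))) (zeroˡ _)

  innerSum-middle : ∀ {n j} → 0 < j → j < n → innerSum n j ≈ 0#
  innerSum-middle {n} {suc j} _ j<n = *-cancelˡ (*-nz two-nz (ι-sub-nz j<n)) (begin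
    D * innerSum n (suc j)  ≈⟨ innerSum-telescoped ⟩
    D * term 0 + G 1        ≈⟨ boundaryTerm-vanishes n j ⟩
    0#                      ≈⟨ sym (zeroʳ D) ⟩
    D * 0#                  ∎)
    where open InnerSum n (suc j)

  innerSum-top : ∀ n → .{{NonZero n}} → ι 2 * innerSum n n ≈ ι (n !) * ι (n !)
  innerSum-top n = begin
    ι 2 * innerSum n n
      ≈⟨ *-congˡ (sumTo-last n _ (λ k k<n → trans (*-congˡ (risingProduct-vanishes k<n)) (zeroʳ _))) ⟩
    ι 2 * ((R * P⁻¹) * (R * rising (ι n) n))
      ≈⟨ solve 4 (λ r p⁻¹ r′ two → two :* ((r :* p⁻¹) :* (r :* r′)) := (r :* r) :* ((two :* r′) :* p⁻¹)) refl R P⁻¹ (rising (ι n) n) (ι 2) ⟩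
    (R * R) * ((ι 2 * rising (ι n) n) * P⁻¹)
      ≈⟨ *-cong (rising-neg-ι-square n) (*-congʳ (rising-ι-double n)) ⟩
    (ι (n !) * ι (n !)) * (rising (ι (suc n)) n * P⁻¹)
      ≈⟨ *-congˡ (⁻¹-inverseʳ (rising (ι (suc n)) n) (poch1n-nz n n)) ⟩
    (ι (n !) * ι (n !)) * 1#
      ≈⟨ *-identityʳ _ ⟩
    ι (n !) * ι (n !)
      ∎
    where
    R = rising (- ι n) n
    P⁻¹ = (rising (ι (suc n)) n ⁻¹) (poch1n-nz n n)

  -- The Jacobi series

  module Series (α x : Carrier) (hα : NotNegInt α) where
    open import Algebra.Properties.CommutativeSemigroup *-commutativeSemigroup using (x∙yz≈y∙xz)

    weight : ℕ → Carrier
    weight j = pow (half1-x x) j /⟨ *-nz (fact-nz j) (pochα-nz hα j) ⟩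

    jacobiP-β≈-α-1 : ∀ k → jacobiP k α hα (- α - 1#) x
                           ≈ (rising (α + 1#) k /⟨ fact-nz k ⟩) * sumTo k (λ j → weight j * risingProduct k j)
    jacobiP-β≈-α-1 k = *-congˡ (sumTo-cong k (λ j _ → begin
      ((rising (- ι k) j * rising (ι k + α + (- α - 1#) + 1#) j) * q j) * pow (half1-x x) j
        ≈⟨ *-congʳ (*-congʳ (*-congˡ (rising-cong (solve 2 (λ κ α → κ :+ α :+ (:- α :- :1) :+ :1 := κ) refl (ι k) α) j))) ⟩
      ((rising (- ι k) j * rising (ι k) j) * q j) * pow (half1-x x) j
        ≈⟨ solve 3 (λ r q h → (r :* q) :* h := (h :* q) :* r) refl (risingProduct k j) (q j) (pow (half1-x x) j) ⟩
      weight j * risingProduct k j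
        ∎))
      where
      q : ℕ → Carrier
      q j = ((ι (j !) * rising (α + 1#) j) ⁻¹) (*-nz (fact-nz j) (pochα-nz hα j))

    summand-expand : ∀ n k → ((rising (- ι n) k * ι (k !)) /⟨ *-nz (poch1n-nz n k) (pochα-nz hα k) ⟩) * jacobiP k α hα (- α - 1#) x
                             ≈ risingRatio n k * sumTo k (λ j → weight j * risingProduct k j)
    summand-expand n k = begin
      ((R * K!) * Q⁻¹) * jacobiP k α hα (- α - 1#) x
        ≈⟨ *-congˡ (jacobiP-β≈-α-1 k) ⟩
      ((R * K!) * Q⁻¹) * ((A * K!⁻¹) * S)
        ≈⟨ solve 6 (λ r f q a f⁻¹ s → ((r :* f) :* q) :* ((a :* f⁻¹) :* s) := ((r :* (q :* a)) :* (f :* f⁻¹)) :* s) refl R K! Q⁻¹ A K!⁻¹ S ⟩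
      ((R * (Q⁻¹ * A)) * (K! * K!⁻¹)) * S
        ≈⟨ *-congʳ (*-cong (*-congˡ (⁻¹-*-cancelʳ (*-nz (poch1n-nz n k) (pochα-nz hα k)) (poch1n-nz n k))) (⁻¹-inverseʳ K! (fact-nz k))) ⟩
      (risingRatio n k * 1#) * S
        ≈⟨ *-congʳ (*-identityʳ _) ⟩
      risingRatio n k * S
        ∎
      where
      R = rising (- ι n) k
      K! = ι (k !)
      K!⁻¹ = (K! ⁻¹) (fact-nz k)
      A = rising (α + 1#) k
      Q⁻¹ = ((rising (ι (suc n)) k * A) ⁻¹) (*-nz (poch1n-nz n k) (pochα-nz hα k))
      S = sumTo k (λ j → weight j * risingProduct k j)

    jacobiSeries-reindex : ∀ n →
      sumTo n (λ k → ((rising (- ι n) k * ι (k !)) /⟨ *-nz (poch1n-nz n k) (pochα-nz hα k) ⟩) * jacobiP k α hα (- α - 1#) x)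
      ≈ sumTo n (λ j → weight j * innerSum n j)
    jacobiSeries-reindex n = begin
      sumTo n (λ k → ((rising (- ι n) k * ι (k !)) /⟨ *-nz (poch1n-nz n k) (pochα-nz hα k) ⟩) * jacobiP k α hα (- α - 1#) x)
        ≈⟨ sumTo-cong n (λ k _ → trans (summand-expand n k) (*-distribˡ-sumTo k (risingRatio n k) _)) ⟩
      sumTo n (λ k → sumTo k (λ j → risingRatio n k * (weight j * risingProduct k j)))
        ≈⟨ sumTo-triangle-comm n _ (λ k j k<j → trans (*-congˡ (trans (*-congˡ (risingProduct-vanishes k<j)) (zeroʳ _))) (zeroʳ _)) ⟩
      sumTo n (λ j → sumTo n (λ k → risingRatio n k * (weight j * risingProduct k j)))
        ≈⟨ sumTo-cong n (λ j _ → trans (sumTo-cong n (λ k _ → x∙yz≈y∙xz _ _ _)) (sym (*-distribˡ-sumTo n (weight j) _))) ⟩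
      sumTo n (λ j → weight j * innerSum n j)
        ∎

    weight-zero : weight 0 ≈ 1#
    weight-zero = trans (*-identityˡ _) (⁻¹-unique _ (solve 0 ((:1 :+ :0) :* :1 :* :1 := :1) refl))

    weightedInnerSums : ∀ n → (ι 2 * rising (α + 1#) n) * sumTo n (λ j → weight j * innerSum n j)
                              ≈ ι (n !) * pow (half1-x x) n + rising (α + 1#) n
    weightedInnerSums zero = begin
      (ι 2 * 1#) * (weight 0 * (risingRatio 0 0 * (1# * 1#)))
        ≈⟨ *-congˡ (*-cong weight-zero (*-congʳ (risingRatio-zero 0))) ⟩
      (ι 2 * 1#) * (1# * (1# * (1# * 1#)))
        ≈⟨ solve 0 ((:2 :* :1) :* (:1 :* (:1 :* (:1 :* :1))) := (:1 :+ :0) :* :1 :+ :1) refl ⟩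
      ι (0 !) * 1# + 1#
        ∎
    weightedInnerSums n@(suc m) = begin
      (ι 2 * A) * (sumTo m f + f n)
        ≈⟨ *-congˡ (+-congʳ (sumTo-first m f (λ k 0<k k≤m → trans (*-congˡ (innerSum-middle 0<k (s≤s k≤m))) (zeroʳ _)))) ⟩
      (ι 2 * A) * (f 0 + f n)
        ≈⟨ solve 6 (λ two a w₀ e₀ w e → (two :* a) :* (w₀ :* e₀ :+ w :* e) := a :* (w₀ :* (two :* e₀)) :+ a :* (w :* (two :* e)))
                   refl (ι 2) A (weight 0) (innerSum n 0) (weight n) (innerSum n n) ⟩
      A * (weight 0 * (ι 2 * innerSum n 0)) + A * (weight n * (ι 2 * innerSum n n))
        ≈⟨ +-cong (*-congˡ (*-cong weight-zero (innerSum-zero n))) (*-congˡ (*-congˡ (innerSum-top n))) ⟩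
      A * (1# * 1#) + A * ((H * Q⁻¹) * (N! * N!))
        ≈⟨ solve 4 (λ a h q⁻¹ f → a :* (:1 :* :1) :+ a :* ((h :* q⁻¹) :* (f :* f)) := (f :* h) :* ((f :* a) :* q⁻¹) :+ a) refl A H Q⁻¹ N! ⟩
      (N! * H) * ((N! * A) * Q⁻¹) + A
        ≈⟨ +-congʳ (trans (*-congˡ (⁻¹-inverseʳ (N! * A) (*-nz (fact-nz n) (pochα-nz hα n)))) (*-identityʳ _)) ⟩
      N! * H + A
        ∎
      where
      f : ℕ → Carrier
      f j = weight j * innerSum n j
      A = rising (α + 1#) n
      H = pow (half1-x x) n
      N! = ι (n !)
      Q⁻¹ = ((N! * A) ⁻¹) (*-nz (fact-nz n) (pochα-nz hα n))

mainTheorem20 : ∀ {c ℓ : Level} (F : CharZeroField c ℓ) →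
    let open CharZeroField F
        open FieldTheory F
    in (α x : Carrier) (hα : NotNegInt α) (n : ℕ) →
       sumTo n (λ k →
         ((rising (- ι n) k * ι (k !))
            /⟨ *-nz (poch1n-nz n k) (pochα-nz hα k) ⟩)
         * jacobiP k α hα (- α - 1#) x)
       ≈ (ι (n !) * pow (half1-x x) n + rising (α + 1#) n)
           /⟨ *-nz two-nz (pochα-nz hα n) ⟩
mainTheorem20 F α x hα n = begin
  _                                        ≈⟨ jacobiSeries-reindex n ⟩
  sumTo n (λ j → weight j * innerSum n j)  ≈⟨ y*z≈x⇒z≈x/y (*-nz two-nz (pochα-nz hα n)) (weightedInnerSums n) ⟩
  _                                        ∎
  where
  open CharZeroField F
  open FieldTheory F
  open SetoidReasoning setoid
  open JacobiSum F
  open Series α x hα
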